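{- Let $n\geq 3$ and let $B_n={\rm Cay}(S_n,S)$ be the bubble-sort graph, where $S=\{(1\,2),(2\,3),\dots,(n-1\,n)\}$. Let $\sigma\in S_n$ be the permutation $i\mapsto n+1-i$. Then every automorphism of $B_n$ can be expressed uniquely in the form $R(a)L(b)$ with $a\in S_n$ and $b\in\{{\rm id},\sigma\}$.
   Context: ${\rm Cay}(S_n,S)$ has vertex set $S_n$, with $h$ adjacent to $sh$ for $h\in S_n$, $s\in S$. For $a\in S_n$, $R(a)$ is the permutation $x\mapsto xa$ of $S_n$ and $L(a)$ is the permutation $x\mapsto a^{ -1}x$ of $S_n$. The set $\{{\rm id},\sigma\}$ is the automorphism group of the transposition graph $T(S)$ (the path $1-2-\cdots-n$ on $\{1,\dots,n\}$ with $i\sim j$ iff $(i\,j)\in S$). -}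

module Defs where

open import Data.Nat using (ℕ; suc)
open import Data.Fin using (Fin; toℕ)
open import Data.Fin.Permutation
  using (Permutation′; _⟨$⟩ʳ_; _≈_; _∘ₚ_; flip; transpose; reverse)
  renaming (id to idₚ)
open import Data.Product using (Σ; ∃; ∃-syntax; _×_; _,_)
open import Data.Sum using (_⊎_)
open import Relation.Binary.PropositionalEquality using (_≡_)

-- The symmetric group S_n: permutations of Fin n (= {1,…,n}, 0-indexed),
-- compared by pointwise equality _≈_.
Sym : ℕ → Set
Sym n = Permutation′ n

-- Group product in S_n with the usual functional convention:
-- (g · h)(i) = g (h i).
infixl 7 _·_
_·_ : ∀ {n} → Sym n → Sym n → Sym n
g · h = h ∘ₚ g

_⁻¹ : ∀ {n} → Sym n → Sym n
g ⁻¹ = flip g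

InS : ∀ {n} → Sym n → Set
InS {n} s = Σ (Fin n) λ i → Σ (Fin n) λ j →
  (toℕ j ≡ suc (toℕ i)) × (s ≈ transpose i j)

Adj : ∀ {n} → Sym n → Sym n → Set
Adj h k = Σ _ λ s → InS s × (k ≈ s · h)

-- σ : i ↦ n + 1 − i  (on 0-indexed Fin n: i ↦ n − 1 − i).
σ : ∀ {n} → Sym n
σ = reverse

R : ∀ {n} → Sym n → Sym n → Sym n
R a x = x · a

L : ∀ {n} → Sym n → Sym n → Sym n
L a x = (a ⁻¹) · x

RL : ∀ {n} → Sym n → Sym n → Sym n → Sym n
RL a b x = R a (L b x)

-- Graph automorphism of B_n: a bijection φ of the vertex set S_n
-- (vertices identified up to pointwise equality) preserving adjacency
-- in both directions.
record IsAutomorphism {n : ℕ} (φ : Sym n → Sym n) : Set where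
  field
    cong        : ∀ {x y} → x ≈ y → φ x ≈ φ y
    injective   : ∀ {x y} → φ x ≈ φ y → x ≈ y
    surjective  : ∀ y → ∃[ x ] (φ x ≈ y)
    adj-pres    : ∀ x y → Adj x y → Adj (φ x) (φ y)
    adj-reflect : ∀ x y → Adj (φ x) (φ y) → Adj x y

InIdσ : ∀ {n} → Sym n → Set
InIdσ b = (b ≈ idₚ) ⊎ (b ≈ σ)

RepresentedBy : ∀ {n} → (Sym n → Sym n) → Sym n → Sym n → Set
RepresentedBy φ a b = ∀ x → φ x ≈ RL a b x

-- Right translations R(a) are automorphisms of B_n, so after composing with one we may assume
-- that φ fixes the identity. Then φ permutes its neighbours, the adjacent transpositions s_k, and
-- the induced map on indices is an automorphism of the path 0 - 1 - ⋯ - (n-2): two commuting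
-- generators have a second common neighbour besides the identity, two adjacent ones have none.
-- So the induced map is the identity or the reversal k ↦ n-2-k, and in the second case conjugation
-- by σ undoes it. An automorphism fixing the identity and all its neighbours is the identity:
-- spreading out from a vertex x all of whose neighbours are fixed, each vertex t s x is pinned
-- down by a 4-cycle when s and t commute and by the 6-cycle of the braid relation s t s = t s t
-- when they do not. Uniqueness holds because σ is not central in S_n for n ≥ 3.

module Submission where

open import Data.Empty using (⊥; ⊥-elim)
open import Data.Fin using (Fin; toℕ; fromℕ<; opposite) renaming (zero to zeroᶠ)
open import Data.Fin.Properties
  using (toℕ-injective; toℕ-fromℕ<; toℕ<n; opposite-prop; opposite-involutive)
  renaming (_≟_ to _≟ᶠ_)
open import Data.Fin.Permutation
  using (_⟨$⟩ʳ_; _⟨$⟩ˡ_; _≈_; transpose; inverseˡ; inverseʳ)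
  renaming (id to idₚ)
open import Data.Fin.Permutation.Transposition.List using (TranspositionList; eval; decompose; eval-decompose)
open import Data.List using (List; []; _∷_; length)
open import Data.Nat using (ℕ; zero; suc; _+_; _∸_; _≤_; _<_; z≤n; s≤s; s≤s⁻¹; z<s; _≟_; _<?_)
open import Data.Nat.Properties
  using ( suc-injective; 1+n≢n; m≢1+n+m; n≤0⇒n≡0; ≤-refl; ≤-trans; ≤-antisym; ≤∧≢⇒<; <-irrefl; <-trans
        ; <⇒≢; <⇒≤; <-cmp; n≤1+n; n<1+n; m<n⇒m<1+n; m≤m+n; m<m+n; m+n≤o⇒n≤o; +-comm; +-suc
        ; +-identityʳ; +-monoʳ-≤; +-cancelˡ-≡; +-cancelʳ-≡; +-cancelˡ-≤; +-cancelʳ-≤; m+[n∸m]≡n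
        ; m+n∸n≡m; module ≤-Reasoning)
open import Data.Product using (Σ; _×_; _,_; proj₁)
open import Data.Sum using (_⊎_; inj₁; inj₂)
open import Function using (_∘_)
open import Relation.Binary using (tri<; tri≈; tri>)
open import Relation.Nullary using (¬_; Dec; yes; no)
open import Relation.Binary.PropositionalEquality

open import Defs

adjSwap : ℕ → ℕ → ℕ
adjSwap zero    zero          = 1
adjSwap zero    (suc zero)    = 0
adjSwap zero    (suc (suc m)) = suc (suc m)
adjSwap (suc k) zero          = zero
adjSwap (suc k) (suc m)       = suc (adjSwap k m)

adjSwap-self : ∀ k → adjSwap k k ≡ suc k
adjSwap-self zero    = refl
adjSwap-self (suc k) = cong suc (adjSwap-self k)

adjSwap-suc : ∀ k → adjSwap k (suc k) ≡ k
adjSwap-suc zero    = refl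
adjSwap-suc (suc k) = cong suc (adjSwap-suc k)

adjSwap-other : ∀ k m → m ≢ k → m ≢ suc k → adjSwap k m ≡ m
adjSwap-other zero    zero          m≢k _    = ⊥-elim (m≢k refl)
adjSwap-other zero    (suc zero)    _   m≢1  = ⊥-elim (m≢1 refl)
adjSwap-other zero    (suc (suc m)) _   _    = refl
adjSwap-other (suc k) zero          _   _    = refl
adjSwap-other (suc k) (suc m)       m≢k m≢sk =
  cong suc (adjSwap-other k m (m≢k ∘ cong suc) (m≢sk ∘ cong suc))

adjSwap-involutive : ∀ k m → adjSwap k (adjSwap k m) ≡ m
adjSwap-involutive zero    zero          = refl
adjSwap-involutive zero    (suc zero)    = refl
adjSwap-involutive zero    (suc (suc m)) = refl
adjSwap-involutive (suc k) zero          = refl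
adjSwap-involutive (suc k) (suc m)       = cong suc (adjSwap-involutive k m)

adjSwap-≤ : ∀ k m → adjSwap k m ≤ suc m
adjSwap-≤ zero    zero          = ≤-refl
adjSwap-≤ zero    (suc zero)    = z≤n
adjSwap-≤ zero    (suc (suc m)) = n≤1+n _
adjSwap-≤ (suc k) zero          = z≤n
adjSwap-≤ (suc k) (suc m)       = s≤s (adjSwap-≤ k m)

adjSwap-≥ : ∀ k m → m ≤ suc (adjSwap k m)
adjSwap-≥ zero    zero          = z≤n
adjSwap-≥ zero    (suc zero)    = ≤-refl
adjSwap-≥ zero    (suc (suc m)) = n≤1+n _
adjSwap-≥ (suc k) zero          = z≤n
adjSwap-≥ (suc k) (suc m)       = s≤s (adjSwap-≥ k m)

adjSwap-rise : ∀ k m → adjSwap k m ≡ suc m → k ≡ m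
adjSwap-rise zero    zero          _  = refl
adjSwap-rise zero    (suc (suc m)) eq = ⊥-elim (1+n≢n (sym eq))
adjSwap-rise (suc k) (suc m)       eq = cong suc (adjSwap-rise k m (suc-injective eq))

adjSwap-fall : ∀ k m → adjSwap k (suc m) ≡ m → k ≡ m
adjSwap-fall zero    zero    _  = refl
adjSwap-fall zero    (suc m) eq = ⊥-elim (1+n≢n eq)
adjSwap-fall (suc k) (suc m) eq = cong suc (adjSwap-fall k m (suc-injective eq))

adjSwap-≥-of-≢ : ∀ k m → k ≢ m → suc m ≤ adjSwap k (suc m)
adjSwap-≥-of-≢ k m k≢m =
  ≤∧≢⇒< (s≤s⁻¹ (adjSwap-≥ k (suc m))) (λ eq → k≢m (adjSwap-fall k m (sym eq)))

-- Behind σ s_k σ = s_{n-2-k}: the reflection q ↦ k + k′ + 1 − q conjugates the swap (k k+1) into (k′ k′+1).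
adjSwap-reflect : ∀ k k′ q q′ → suc (k + k′) ≡ q + q′ → adjSwap k q + adjSwap k′ q′ ≡ q + q′
adjSwap-reflect k k′ q q′ eq with q ≟ k | q ≟ suc k
... | yes refl | _ = begin
  adjSwap q q + adjSwap k′ q′         ≡⟨ cong₂ _+_ (adjSwap-self q) (cong (adjSwap k′) q′≡sk′) ⟩
  suc q + adjSwap k′ (suc k′)         ≡⟨ cong (suc q +_) (adjSwap-suc k′) ⟩
  suc q + k′                          ≡⟨ eq ⟩
  q + q′                              ∎
  where
  open ≡-Reasoning
  q′≡sk′ : q′ ≡ suc k′
  q′≡sk′ = +-cancelˡ-≡ q _ _ (trans (sym eq) (sym (+-suc q k′)))
... | no _ | yes refl = begin
  adjSwap k (suc k) + adjSwap k′ q′   ≡⟨ cong₂ _+_ (adjSwap-suc k) (cong (adjSwap k′) q′≡k′) ⟩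
  k + adjSwap k′ k′                   ≡⟨ cong (k +_) (adjSwap-self k′) ⟩
  k + suc k′                          ≡⟨ +-suc k k′ ⟩
  suc (k + k′)                        ≡⟨ eq ⟩
  suc k + q′                          ∎
  where
  open ≡-Reasoning
  q′≡k′ : q′ ≡ k′
  q′≡k′ = +-cancelˡ-≡ k _ _ (suc-injective (sym eq))
... | no q≢k | no q≢sk = cong₂ _+_ (adjSwap-other k q q≢k q≢sk) (adjSwap-other k′ q′ q′≢k′ q′≢sk′)
  where
  q′≢k′ : q′ ≢ k′
  q′≢k′ refl = q≢sk (+-cancelʳ-≡ q′ q (suc k) (sym eq))
  q′≢sk′ : q′ ≢ suc k′
  q′≢sk′ refl = q≢k (+-cancelʳ-≡ (suc k′) q k (trans (sym eq) (sym (+-suc k k′))))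

Adjacent : ℕ → ℕ → Set
Adjacent i j = j ≡ suc i ⊎ i ≡ suc j

Far : ℕ → ℕ → Set
Far i j = i ≢ j × ¬ Adjacent i j

Adjacent-sym : ∀ {i j} → Adjacent i j → Adjacent j i
Adjacent-sym (inj₁ eq) = inj₂ eq
Adjacent-sym (inj₂ eq) = inj₁ eq

Adjacent⇒≢ : ∀ {i j} → Adjacent i j → i ≢ j
Adjacent⇒≢ (inj₁ j≡si) refl = 1+n≢n (sym j≡si)
Adjacent⇒≢ (inj₂ i≡sj) refl = 1+n≢n (sym i≡sj)

Far-sym : ∀ {i j} → Far i j → Far j i
Far-sym (i≢j , ¬adj) = ≢-sym i≢j , λ where
  (inj₁ eq) → ¬adj (inj₂ eq)
  (inj₂ eq) → ¬adj (inj₁ eq)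

Far-pred : ∀ {i j} → Far (suc i) (suc j) → Far i j
Far-pred (i≢j , ¬adj) = i≢j ∘ cong suc , λ where
  (inj₁ eq) → ¬adj (inj₁ (cong suc eq))
  (inj₂ eq) → ¬adj (inj₂ (cong suc eq))

classify : ∀ i j → i ≡ j ⊎ Adjacent i j ⊎ Far i j
classify i j with i ≟ j | j ≟ suc i | i ≟ suc j
... | yes i≡j | _        | _        = inj₁ i≡j
... | no  _   | yes j≡si | _        = inj₂ (inj₁ (inj₁ j≡si))
... | no  _   | no  _    | yes i≡sj = inj₂ (inj₁ (inj₂ i≡sj))
... | no  i≢j | no  j≢si | no  i≢sj = inj₂ (inj₂ (i≢j , λ where
  (inj₁ eq) → j≢si eq
  (inj₂ eq) → i≢sj eq))

adjSwap-comm : ∀ i j → Far i j → ∀ q → adjSwap i (adjSwap j q) ≡ adjSwap j (adjSwap i q)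
adjSwap-comm zero          zero          (i≢j , _) q = ⊥-elim (i≢j refl)
adjSwap-comm zero          (suc zero)    (_ , ¬adj) q = ⊥-elim (¬adj (inj₁ refl))
adjSwap-comm (suc zero)    zero          (_ , ¬adj) q = ⊥-elim (¬adj (inj₂ refl))
adjSwap-comm zero          (suc (suc j)) _ zero                = refl
adjSwap-comm zero          (suc (suc j)) _ (suc zero)          = refl
adjSwap-comm zero          (suc (suc j)) _ (suc (suc q))       = refl
adjSwap-comm (suc (suc i)) zero          _ zero                = refl
adjSwap-comm (suc (suc i)) zero          _ (suc zero)          = refl
adjSwap-comm (suc (suc i)) zero          _ (suc (suc q))       = refl
adjSwap-comm (suc i)       (suc j)       _ zero                = refl
adjSwap-comm (suc i)       (suc j)       far (suc q) = cong suc (adjSwap-comm i j (Far-pred far) q)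

adjSwap-braid-suc : ∀ i q →
  adjSwap i (adjSwap (suc i) (adjSwap i q)) ≡ adjSwap (suc i) (adjSwap i (adjSwap (suc i) q))
adjSwap-braid-suc zero    zero                = refl
adjSwap-braid-suc zero    (suc zero)          = refl
adjSwap-braid-suc zero    (suc (suc zero))    = refl
adjSwap-braid-suc zero    (suc (suc (suc q))) = refl
adjSwap-braid-suc (suc i) zero                = refl
adjSwap-braid-suc (suc i) (suc q)             = cong suc (adjSwap-braid-suc i q)

adjSwap-braid : ∀ {i j} → Adjacent i j → ∀ q →
  adjSwap i (adjSwap j (adjSwap i q)) ≡ adjSwap j (adjSwap i (adjSwap j q))
adjSwap-braid (inj₁ refl) = adjSwap-braid-suc _
adjSwap-braid (inj₂ refl) q = sym (adjSwap-braid-suc _ q)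

adjSwaps : List ℕ → ℕ → ℕ
adjSwaps []       m = m
adjSwaps (k ∷ ks) m = adjSwaps ks (adjSwap k m)

adjSwaps-≤ : ∀ ks m → adjSwaps ks m ≤ length ks + m
adjSwaps-≤ []       m = ≤-refl
adjSwaps-≤ (k ∷ ks) m = begin
  adjSwaps ks (adjSwap k m) ≤⟨ adjSwaps-≤ ks (adjSwap k m) ⟩
  length ks + adjSwap k m   ≤⟨ +-monoʳ-≤ (length ks) (adjSwap-≤ k m) ⟩
  length ks + suc m         ≡⟨ +-suc (length ks) m ⟩
  suc (length ks + m)       ∎
  where open ≤-Reasoning

adjSwaps-≥ : ∀ ks m → m ≤ length ks + adjSwaps ks m
adjSwaps-≥ []       m = ≤-refl
adjSwaps-≥ (k ∷ ks) m = begin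
  m                                       ≤⟨ adjSwap-≥ k m ⟩
  suc (adjSwap k m)                       ≤⟨ s≤s (adjSwaps-≥ ks (adjSwap k m)) ⟩
  suc (length ks + adjSwaps ks (adjSwap k m)) ∎
  where open ≤-Reasoning

adjSwaps-rise : ∀ k ks m → adjSwaps (k ∷ ks) m ≡ length (k ∷ ks) + m → k ≡ m
adjSwaps-rise k ks m eq = adjSwap-rise k m (≤-antisym (adjSwap-≤ k m) (+-cancelˡ-≤ (length ks) _ _ (begin
  length ks + suc m         ≡⟨ +-suc (length ks) m ⟩
  suc (length ks + m)       ≡⟨ eq ⟨
  adjSwaps ks (adjSwap k m) ≤⟨ adjSwaps-≤ ks (adjSwap k m) ⟩
  length ks + adjSwap k m   ∎)))
  where open ≤-Reasoning

adjSwaps-fall : ∀ k ks m → adjSwaps (k ∷ ks) (length (k ∷ ks) + m) ≡ m → k ≡ length ks + m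
adjSwaps-fall k ks m eq = adjSwap-fall k (length ks + m) (≤-antisym (begin
  adjSwap k (suc (length ks + m))             ≤⟨ adjSwaps-≥ ks _ ⟩
  length ks + adjSwaps ks (adjSwap k (suc (length ks + m))) ≡⟨ cong (length ks +_) eq ⟩
  length ks + m                               ∎) (s≤s⁻¹ (adjSwap-≥ k _)))
  where open ≤-Reasoning

ascending-staircase : ∀ {i j k} a b c → j ≡ suc i → i ≡ suc k →
  adjSwaps (a ∷ b ∷ c ∷ []) k ≡ adjSwaps (k ∷ i ∷ j ∷ []) k → a ≡ k
ascending-staircase {k = k} a b c refl refl eq = adjSwaps-rise a (b ∷ c ∷ []) k (begin
  adjSwaps (a ∷ b ∷ c ∷ []) k                            ≡⟨ eq ⟩
  adjSwap (2 + k) (adjSwap (1 + k) (adjSwap k k))         ≡⟨ cong (adjSwap (2 + k) ∘ adjSwap (1 + k)) (adjSwap-self k) ⟩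
  adjSwap (2 + k) (adjSwap (1 + k) (1 + k))               ≡⟨ cong (adjSwap (2 + k)) (adjSwap-self (1 + k)) ⟩
  adjSwap (2 + k) (2 + k)                                 ≡⟨ adjSwap-self (2 + k) ⟩
  3 + k                                                   ∎)
  where open ≡-Reasoning

descending-staircase : ∀ {i j k} a b c → i ≡ suc j → k ≡ suc i →
  adjSwaps (a ∷ b ∷ c ∷ []) (suc k) ≡ adjSwaps (k ∷ i ∷ j ∷ []) (suc k) → a ≡ k
descending-staircase {j = j} a b c refl refl eq = adjSwaps-fall a (b ∷ c ∷ []) j (begin
  adjSwaps (a ∷ b ∷ c ∷ []) (3 + j)                       ≡⟨ eq ⟩
  adjSwap j (adjSwap (1 + j) (adjSwap (2 + j) (3 + j)))    ≡⟨ cong (adjSwap j ∘ adjSwap (1 + j)) (adjSwap-suc (2 + j)) ⟩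
  adjSwap j (adjSwap (1 + j) (2 + j))                      ≡⟨ cong (adjSwap j) (adjSwap-suc (1 + j)) ⟩
  adjSwap j (1 + j)                                        ≡⟨ adjSwap-suc j ⟩
  j                                                        ∎)
  where open ≡-Reasoning

transposeℕ : ℕ → ℕ → ℕ → ℕ
transposeℕ a b q with q ≟ a
... | yes _ = b
... | no  _ with q ≟ b
...   | yes _ = a
...   | no  _ = q

transposeℕ-left : ∀ a b → transposeℕ a b a ≡ b
transposeℕ-left a b with a ≟ a
... | yes _   = refl
... | no  a≢a = ⊥-elim (a≢a refl)

transposeℕ-right : ∀ a b → transposeℕ a b b ≡ a
transposeℕ-right a b with b ≟ a
... | yes b≡a = b≡a
... | no  _ with b ≟ b
...   | yes _   = refl
...   | no  b≢b = ⊥-elim (b≢b refl)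

transposeℕ-other : ∀ a b q → q ≢ a → q ≢ b → transposeℕ a b q ≡ q
transposeℕ-other a b q q≢a q≢b with q ≟ a
... | yes q≡a = ⊥-elim (q≢a q≡a)
... | no  _ with q ≟ b
...   | yes q≡b = ⊥-elim (q≢b q≡b)
...   | no  _   = refl

transposeℕ-comm : ∀ a b q → transposeℕ a b q ≡ transposeℕ b a q
transposeℕ-comm a b q = cases (q ≟ a) (q ≟ b)
  where
  cases : Dec (q ≡ a) → Dec (q ≡ b) → transposeℕ a b q ≡ transposeℕ b a q
  cases (yes refl) (yes refl) = refl
  cases (yes refl) (no  _)    = trans (transposeℕ-left q b) (sym (transposeℕ-right b q))
  cases (no  _)    (yes refl) = trans (transposeℕ-right a q) (sym (transposeℕ-left q a))
  cases (no  q≢a)  (no  q≢b)  = trans (transposeℕ-other a b q q≢a q≢b) (sym (transposeℕ-other b a q q≢b q≢a))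

transposeℕ-self : ∀ a q → transposeℕ a a q ≡ q
transposeℕ-self a q = cases (q ≟ a)
  where
  cases : Dec (q ≡ a) → transposeℕ a a q ≡ q
  cases (yes refl) = transposeℕ-left q q
  cases (no  q≢a)  = transposeℕ-other a a q q≢a q≢a

transposeℕ-suc : ∀ k q → transposeℕ k (suc k) q ≡ adjSwap k q
transposeℕ-suc k q = cases (q ≟ k) (q ≟ suc k)
  where
  cases : Dec (q ≡ k) → Dec (q ≡ suc k) → transposeℕ k (suc k) q ≡ adjSwap k q
  cases (yes refl) _          = trans (transposeℕ-left q (suc q)) (sym (adjSwap-self q))
  cases (no  _)    (yes refl) = trans (transposeℕ-right k (suc k)) (sym (adjSwap-suc k))
  cases (no  q≢k)  (no  q≢sk) = trans (transposeℕ-other k (suc k) q q≢k q≢sk) (sym (adjSwap-other k q q≢k q≢sk))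

transposeℕ-conj : ∀ a c → a < c → ∀ q → transposeℕ a (suc c) q ≡ adjSwap c (transposeℕ a c (adjSwap c q))
transposeℕ-conj a c a<c q = cases (q ≟ a) (q ≟ c) (q ≟ suc c)
  where
  cases : Dec (q ≡ a) → Dec (q ≡ c) → Dec (q ≡ suc c) →
          transposeℕ a (suc c) q ≡ adjSwap c (transposeℕ a c (adjSwap c q))
  cases (yes refl) _ _ = begin
    transposeℕ q (suc c) q               ≡⟨ transposeℕ-left q (suc c) ⟩
    suc c                                ≡⟨ adjSwap-self c ⟨
    adjSwap c c                          ≡⟨ cong (adjSwap c) (transposeℕ-left q c) ⟨
    adjSwap c (transposeℕ q c q)         ≡⟨ cong (λ z → adjSwap c (transposeℕ q c z)) (adjSwap-other c q a≢c a≢sc) ⟨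
    adjSwap c (transposeℕ q c (adjSwap c q)) ∎
    where
    open ≡-Reasoning
    a≢c = <⇒≢ a<c
    a≢sc = <⇒≢ (m<n⇒m<1+n a<c)
  cases (no q≢a) (yes refl) _ = begin
    transposeℕ a (suc q) q                   ≡⟨ transposeℕ-other a (suc q) q q≢a (≢-sym (1+n≢n {q})) ⟩
    q                                        ≡⟨ adjSwap-suc q ⟨
    adjSwap q (suc q)                        ≡⟨ cong (adjSwap q) (transposeℕ-other a q (suc q) (≢-sym a≢sq) 1+n≢n) ⟨
    adjSwap q (transposeℕ a q (suc q))       ≡⟨ cong (λ z → adjSwap q (transposeℕ a q z)) (adjSwap-self q) ⟨
    adjSwap q (transposeℕ a q (adjSwap q q)) ∎
    where
    open ≡-Reasoning
    a≢sq = <⇒≢ (m<n⇒m<1+n a<c)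
  cases (no _) (no _) (yes refl) = begin
    transposeℕ a (suc c) (suc c)                   ≡⟨ transposeℕ-right a (suc c) ⟩
    a                                              ≡⟨ adjSwap-other c a (<⇒≢ a<c) (<⇒≢ (m<n⇒m<1+n a<c)) ⟨
    adjSwap c a                                    ≡⟨ cong (adjSwap c) (transposeℕ-right a c) ⟨
    adjSwap c (transposeℕ a c c)                   ≡⟨ cong (λ z → adjSwap c (transposeℕ a c z)) (adjSwap-suc c) ⟨
    adjSwap c (transposeℕ a c (adjSwap c (suc c))) ∎
    where open ≡-Reasoning
  cases (no q≢a) (no q≢c) (no q≢sc) = begin
    transposeℕ a (suc c) q                   ≡⟨ transposeℕ-other a (suc c) q q≢a q≢sc ⟩
    q                                        ≡⟨ adjSwap-other c q q≢c q≢sc ⟨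
    adjSwap c q                              ≡⟨ cong (adjSwap c) (transposeℕ-other a c q q≢a q≢c) ⟨
    adjSwap c (transposeℕ a c q)             ≡⟨ cong (λ z → adjSwap c (transposeℕ a c z)) (adjSwap-other c q q≢c q≢sc) ⟨
    adjSwap c (transposeℕ a c (adjSwap c q)) ∎
    where open ≡-Reasoning

module _ {n : ℕ} where

  ·-inverseʳ : (g : Sym n) → g · g ⁻¹ ≈ idₚ
  ·-inverseʳ g m = inverseʳ g

  ·-cancelʳ : {g h : Sym n} (x : Sym n) → g · x ≈ h · x → g ≈ h
  ·-cancelʳ {g} {h} x gx≈hx m = begin
    g ⟨$⟩ʳ m                       ≡⟨ cong (g ⟨$⟩ʳ_) (inverseʳ x) ⟨
    g ⟨$⟩ʳ (x ⟨$⟩ʳ (x ⟨$⟩ˡ m))     ≡⟨ gx≈hx (x ⟨$⟩ˡ m) ⟩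
    h ⟨$⟩ʳ (x ⟨$⟩ʳ (x ⟨$⟩ˡ m))     ≡⟨ cong (h ⟨$⟩ʳ_) (inverseʳ x) ⟩
    h ⟨$⟩ʳ m                       ∎
    where open ≡-Reasoning

  ·-cancelˡ : (g : Sym n) {x y : Sym n} → g · x ≈ g · y → x ≈ y
  ·-cancelˡ g gx≈gy m = trans (sym (inverseˡ g)) (trans (cong (g ⟨$⟩ˡ_) (gx≈gy m)) (inverseˡ g))

record IsAdjSwap {n : ℕ} (k : ℕ) (p : Sym n) : Set where
  field toℕ-apply : ∀ m → toℕ (p ⟨$⟩ʳ m) ≡ adjSwap k (toℕ m)
open IsAdjSwap public

module _ {n : ℕ} where

  toℕ-transpose : (i j m : Fin n) → toℕ (transpose i j ⟨$⟩ʳ m) ≡ transposeℕ (toℕ i) (toℕ j) (toℕ m)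
  toℕ-transpose i j m with m ≟ᶠ i
  ... | yes refl = sym (transposeℕ-left (toℕ m) (toℕ j))
  ... | no m≢i with m ≟ᶠ j
  ...   | yes refl = sym (transposeℕ-right (toℕ i) (toℕ m))
  ...   | no m≢j = sym (transposeℕ-other (toℕ i) (toℕ j) (toℕ m) (m≢i ∘ toℕ-injective) (m≢j ∘ toℕ-injective))

  transpose-isAdjSwap : (i j : Fin n) → toℕ j ≡ suc (toℕ i) → IsAdjSwap (toℕ i) (transpose i j)
  transpose-isAdjSwap i j j≡si = record { toℕ-apply = λ m → begin
    toℕ (transpose i j ⟨$⟩ʳ m)              ≡⟨ toℕ-transpose i j m ⟩
    transposeℕ (toℕ i) (toℕ j) (toℕ m)       ≡⟨ cong (λ z → transposeℕ (toℕ i) z (toℕ m)) j≡si ⟩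
    transposeℕ (toℕ i) (suc (toℕ i)) (toℕ m) ≡⟨ transposeℕ-suc (toℕ i) (toℕ m) ⟩
    adjSwap (toℕ i) (toℕ m)                  ∎ }
    where open ≡-Reasoning

  IsAdjSwap-· : {k l : ℕ} {p q : Sym n} → IsAdjSwap k p → IsAdjSwap l q →
                ∀ m → toℕ ((p · q) ⟨$⟩ʳ m) ≡ adjSwap k (adjSwap l (toℕ m))
  IsAdjSwap-· {k} p-swap q-swap m = trans (toℕ-apply p-swap _) (cong (adjSwap k) (toℕ-apply q-swap m))

  module _ {k l : ℕ} {p q : Sym n} (p-swap : IsAdjSwap k p) (q-swap : IsAdjSwap l q) where

    IsAdjSwap-unique : k ≡ l → p ≈ q
    IsAdjSwap-unique refl m = toℕ-injective (trans (toℕ-apply p-swap m) (sym (toℕ-apply q-swap m)))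

    IsAdjSwap-injective : p ≈ q → (m : Fin n) → toℕ m ≡ k → l ≡ k
    IsAdjSwap-injective p≈q m refl = adjSwap-rise l (toℕ m) (begin
      adjSwap l (toℕ m)   ≡⟨ toℕ-apply q-swap m ⟨
      toℕ (q ⟨$⟩ʳ m)      ≡⟨ cong toℕ (p≈q m) ⟨
      toℕ (p ⟨$⟩ʳ m)      ≡⟨ toℕ-apply p-swap m ⟩
      adjSwap k k         ≡⟨ adjSwap-self k ⟩
      suc k               ∎)
      where open ≡-Reasoning

    IsAdjSwap-comm : Far k l → p · q ≈ q · p
    IsAdjSwap-comm far m = toℕ-injective (begin
      toℕ ((p · q) ⟨$⟩ʳ m)              ≡⟨ IsAdjSwap-· p-swap q-swap m ⟩
      adjSwap k (adjSwap l (toℕ m))     ≡⟨ adjSwap-comm k l far (toℕ m) ⟩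
      adjSwap l (adjSwap k (toℕ m))     ≡⟨ IsAdjSwap-· q-swap p-swap m ⟨
      toℕ ((q · p) ⟨$⟩ʳ m)              ∎)
      where open ≡-Reasoning

    IsAdjSwap-braid : Adjacent k l → p · q · p ≈ q · p · q
    IsAdjSwap-braid adj m = toℕ-injective (begin
      toℕ (p ⟨$⟩ʳ (q ⟨$⟩ʳ (p ⟨$⟩ʳ m)))                 ≡⟨ IsAdjSwap-· p-swap q-swap _ ⟩
      adjSwap k (adjSwap l (toℕ (p ⟨$⟩ʳ m)))            ≡⟨ cong (adjSwap k ∘ adjSwap l) (toℕ-apply p-swap m) ⟩
      adjSwap k (adjSwap l (adjSwap k (toℕ m)))         ≡⟨ adjSwap-braid adj (toℕ m) ⟩
      adjSwap l (adjSwap k (adjSwap l (toℕ m)))         ≡⟨ cong (adjSwap l ∘ adjSwap k) (toℕ-apply q-swap m) ⟨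
      adjSwap l (adjSwap k (toℕ (q ⟨$⟩ʳ m)))            ≡⟨ IsAdjSwap-· q-swap p-swap _ ⟨
      toℕ (q ⟨$⟩ʳ (p ⟨$⟩ʳ (q ⟨$⟩ʳ m)))                 ∎)
      where open ≡-Reasoning

  IsAdjSwap-involutive : {k : ℕ} {p : Sym n} → IsAdjSwap k p → p · p ≈ idₚ
  IsAdjSwap-involutive {k} p-swap m =
    toℕ-injective (trans (IsAdjSwap-· p-swap p-swap m) (adjSwap-involutive k (toℕ m)))

  IsAdjSwap-resp : {k : ℕ} {p q : Sym n} → p ≈ q → IsAdjSwap k q → IsAdjSwap k p
  IsAdjSwap-resp p≈q q-swap = record { toℕ-apply = λ m → trans (cong toℕ (p≈q m)) (toℕ-apply q-swap m) }

-- InS repackaged as a record, so that s can be inferred from a proof of Generator s.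
record Generator {n : ℕ} (s : Sym n) : Set where
  field
    index       : ℕ
    index-bound : suc index < n
    isAdjSwap   : IsAdjSwap index s
open Generator public

module _ {n : ℕ} where

  point : (k : ℕ) → suc k < n → Fin n
  point k sk<n = fromℕ< (<-trans (n<1+n k) sk<n)

  generator : (k : ℕ) → suc k < n → Sym n
  generator k sk<n = transpose (point k sk<n) (fromℕ< sk<n)

  private
    toℕ-fromℕ<-suc : ∀ {k} (sk<n : suc k < n) → toℕ (fromℕ< sk<n) ≡ suc (toℕ (point k sk<n))
    toℕ-fromℕ<-suc sk<n = trans (toℕ-fromℕ< sk<n) (cong suc (sym (toℕ-fromℕ< _)))

  generator-isAdjSwap : ∀ k (sk<n : suc k < n) → IsAdjSwap k (generator k sk<n)
  generator-isAdjSwap k sk<n = subst (λ i → IsAdjSwap i (generator k sk<n)) (toℕ-fromℕ< _)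
    (transpose-isAdjSwap (point k sk<n) (fromℕ< sk<n) (toℕ-fromℕ<-suc sk<n))

  Generator⇒InS : {s : Sym n} → Generator s → InS s
  Generator⇒InS s-gen = _ , _ , toℕ-fromℕ<-suc (index-bound s-gen) ,
    IsAdjSwap-unique (isAdjSwap s-gen) (generator-isAdjSwap _ (index-bound s-gen)) refl

  InS⇒Generator : {s : Sym n} → InS s → Generator s
  InS⇒Generator (i , j , j≡si , s≈ij) = record
    { index       = toℕ i
    ; index-bound = subst (_< n) j≡si (toℕ<n j)
    ; isAdjSwap   = IsAdjSwap-resp s≈ij (transpose-isAdjSwap i j j≡si) }

  generator-Generator : ∀ k (sk<n : suc k < n) → Generator (generator k sk<n)
  generator-Generator k sk<n = record { index = k ; index-bound = sk<n ; isAdjSwap = generator-isAdjSwap k sk<n }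

  lower : {s : Sym n} → Generator s → Fin n
  lower s-gen = point (index s-gen) (index-bound s-gen)

  toℕ-lower : {s : Sym n} (s-gen : Generator s) → toℕ (lower s-gen) ≡ index s-gen
  toℕ-lower s-gen = toℕ-fromℕ< _

  upper : {s : Sym n} → Generator s → Fin n
  upper s-gen = fromℕ< (index-bound s-gen)

  toℕ-upper : {s : Sym n} (s-gen : Generator s) → toℕ (upper s-gen) ≡ suc (index s-gen)
  toℕ-upper s-gen = toℕ-fromℕ< _

  module _ {s t : Sym n} (s-gen : Generator s) (t-gen : Generator t) where

    Generator-unique : index s-gen ≡ index t-gen → s ≈ t
    Generator-unique = IsAdjSwap-unique (isAdjSwap s-gen) (isAdjSwap t-gen)

    index-cong : s ≈ t → index t-gen ≡ index s-gen
    index-cong s≈t = IsAdjSwap-injective (isAdjSwap s-gen) (isAdjSwap t-gen) s≈t (lower s-gen) (toℕ-lower s-gen)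

module _ {n : ℕ} {s t u v : Sym n}
         (s-gen : Generator s) (t-gen : Generator t) (u-gen : Generator u) (v-gen : Generator v)
         (us≈vt : u · s ≈ v · t) where

  private
    i = index s-gen
    j = index t-gen
    k = index u-gen
    l = index v-gen

    evaluate : ∀ (m : Fin n) {c} → toℕ m ≡ c → adjSwap k (adjSwap i c) ≡ adjSwap l (adjSwap j c)
    evaluate m refl = begin
      adjSwap k (adjSwap i (toℕ m)) ≡⟨ IsAdjSwap-· (isAdjSwap u-gen) (isAdjSwap s-gen) m ⟨
      toℕ ((u · s) ⟨$⟩ʳ m)          ≡⟨ cong toℕ (us≈vt m) ⟩
      toℕ ((v · t) ⟨$⟩ʳ m)          ≡⟨ IsAdjSwap-· (isAdjSwap v-gen) (isAdjSwap t-gen) m ⟩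
      adjSwap l (adjSwap j (toℕ m)) ∎
      where open ≡-Reasoning

  square-far : Far i j → k ≢ i → l ≡ i
  square-far (i≢j , ¬adj) k≢i = adjSwap-rise l i (≤-antisym (adjSwap-≤ l i) (begin
    suc i                    ≤⟨ adjSwap-≥-of-≢ k i k≢i ⟩
    adjSwap k (suc i)        ≡⟨ cong (adjSwap k) (adjSwap-self i) ⟨
    adjSwap k (adjSwap i i)  ≡⟨ evaluate (lower s-gen) (toℕ-lower s-gen) ⟩
    adjSwap l (adjSwap j i)  ≡⟨ cong (adjSwap l) (adjSwap-other j i i≢j (¬adj ∘ inj₂)) ⟩
    adjSwap l i              ∎))
    where open ≤-Reasoning

  square-adjacent : j ≡ suc i → l ≡ j
  square-adjacent refl with l ≟ j
  ... | yes l≡j = l≡j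
  ... | no  l≢j = ⊥-elim (<-irrefl refl (begin
    suc (suc i)              ≤⟨ adjSwap-≥-of-≢ l j l≢j ⟩
    adjSwap l (suc j)        ≡⟨ cong (adjSwap l) (adjSwap-self j) ⟨
    adjSwap l (adjSwap j j)  ≡⟨ evaluate (upper s-gen) (toℕ-upper s-gen) ⟨
    adjSwap k (adjSwap i j)  ≡⟨ cong (adjSwap k) (adjSwap-suc i) ⟩
    adjSwap k i              ≤⟨ adjSwap-≤ k i ⟩
    suc i                    ∎))
    where open ≤-Reasoning

module _ {n : ℕ} {s t u v w w′ : Sym n}
         (s-gen : Generator s) (t-gen : Generator t) (u-gen : Generator u)
         (v-gen : Generator v) (w-gen : Generator w) (w′-gen : Generator w′) where

  private
    toℕ-word : ∀ {p q r : Sym n} (p-gen : Generator p) (q-gen : Generator q) (r-gen : Generator r) m →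
               toℕ ((p · (q · r)) ⟨$⟩ʳ m) ≡ adjSwaps (index r-gen ∷ index q-gen ∷ index p-gen ∷ []) (toℕ m)
    toℕ-word p-gen q-gen r-gen m =
      trans (IsAdjSwap-· (isAdjSwap p-gen) (isAdjSwap q-gen) _)
            (cong (adjSwap _ ∘ adjSwap _) (toℕ-apply (isAdjSwap r-gen) m))

    words : t · (s · u) ≈ w′ · (w · v) → ∀ (m : Fin n) {c} → toℕ m ≡ c →
            adjSwaps (index v-gen ∷ index w-gen ∷ index w′-gen ∷ []) c ≡
            adjSwaps (index u-gen ∷ index s-gen ∷ index t-gen ∷ []) c
    words tsu≈w′wv m refl = trans (sym (toℕ-word w′-gen w-gen v-gen m))
                              (trans (cong toℕ (sym (tsu≈w′wv m))) (toℕ-word t-gen s-gen u-gen m))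

  -- t s u is a staircase of three adjacent swaps, whose only reduced word ends in u.
  staircase-unique : Adjacent (index s-gen) (index t-gen) → Adjacent (index s-gen) (index u-gen) →
                     index u-gen ≢ index t-gen → t · (s · u) ≈ w′ · (w · v) → index v-gen ≡ index u-gen
  staircase-unique (inj₁ j≡si) (inj₁ k≡si) k≢j _ = ⊥-elim (k≢j (trans k≡si (sym j≡si)))
  staircase-unique (inj₂ i≡sj) (inj₂ i≡sk) k≢j _ = ⊥-elim (k≢j (suc-injective (trans (sym i≡sk) i≡sj)))
  staircase-unique (inj₁ j≡si) (inj₂ i≡sk) _ tsu≈w′wv =
    ascending-staircase _ _ _ j≡si i≡sk (words tsu≈w′wv (lower u-gen) (toℕ-lower u-gen))
  staircase-unique (inj₂ i≡sj) (inj₁ k≡si) _ tsu≈w′wv =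
    descending-staircase _ _ _ i≡sj k≡si (words tsu≈w′wv (upper u-gen) (toℕ-upper u-gen))

far-product-≉-id : ∀ {n} {p q : Sym n} (p-gen : Generator p) (q-gen : Generator q) →
                   Far (index p-gen) (index q-gen) → ¬ (p · q ≈ idₚ)
far-product-≉-id {p = p} {q} p-gen q-gen (a≢b , ¬adj) pq≈id = 1+n≢n (begin
  suc a                                     ≡⟨ adjSwap-self a ⟨
  adjSwap a a                               ≡⟨ cong (adjSwap a) (adjSwap-other b a a≢b (¬adj ∘ inj₂)) ⟨
  adjSwap a (adjSwap b a)                   ≡⟨ cong (adjSwap a ∘ adjSwap b) (toℕ-lower p-gen) ⟨
  adjSwap a (adjSwap b (toℕ (lower p-gen))) ≡⟨ IsAdjSwap-· (isAdjSwap p-gen) (isAdjSwap q-gen) _ ⟨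
  toℕ ((p · q) ⟨$⟩ʳ lower p-gen)             ≡⟨ cong toℕ (pq≈id _) ⟩
  toℕ (lower p-gen)                         ≡⟨ toℕ-lower p-gen ⟩
  a                                         ∎)
  where
  open ≡-Reasoning
  a = index p-gen
  b = index q-gen

-- Rigidity of automorphisms fixing the identity and its neighbours

backtrack : ∀ {n} {s t x : Sym n} → Generator s → t · (s · x) ≈ x → t ≈ s
backtrack {s = s} {t} {x} s-gen tsx≈x =
  ·-cancelʳ {g = t} {s} s (·-cancelʳ {g = t · s} {s · s} x λ m →
    trans (tsx≈x m) (sym (IsAdjSwap-involutive (isAdjSwap s-gen) (x ⟨$⟩ʳ m))))

record IsEmbedding {n : ℕ} (θ : Sym n → Sym n) : Set where
  field
    resp-≈    : ∀ {x y} → x ≈ y → θ x ≈ θ y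
    injective : ∀ {x y} → θ x ≈ θ y → x ≈ y
    adj-pres  : ∀ x y → Adj x y → Adj (θ x) (θ y)

module Rigidity {n : ℕ} {θ : Sym n → Sym n} (θ-emb : IsEmbedding θ) where
  open IsEmbedding θ-emb renaming (resp-≈ to θ-cong)

  neighbour-image : ∀ {y y′ t : Sym n} → θ y ≈ y′ → Generator t → Σ (Sym n) λ u → Generator u × θ (t · y) ≈ u · y′
  neighbour-image {y} {t = t} θy≈y′ t-gen with adj-pres y (t · y) (t , Generator⇒InS t-gen , λ _ → refl)
  ... | u , uS , θty≈uθy = u , InS⇒Generator uS , λ m → trans (θty≈uθy m) (cong (u ⟨$⟩ʳ_) (θy≈y′ m))

  module _ {x : Sym n} (θx≈x : θ x ≈ x) (θ-fixes-nbrs : ∀ {u} → Generator u → θ (u · x) ≈ u · x) where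

    back-edge : ∀ {s t u} → Generator s → θ (t · (s · x)) ≈ u · (s · x) → u ≈ s → t ≈ s
    back-edge {s} {t} s-gen θtsx≈usx u≈s = backtrack {t = t} {x} s-gen (injective {t · (s · x)} {x} λ m →
      trans (θtsx≈usx m) (trans (u≈s _) (trans (IsAdjSwap-involutive (isAdjSwap s-gen) _) (sym (θx≈x m)))))

    fixed-far : ∀ {s t} (s-gen : Generator s) (t-gen : Generator t) →
                Far (index s-gen) (index t-gen) → θ (t · (s · x)) ≈ t · (s · x)
    fixed-far {s} {t} s-gen t-gen far
      with neighbour-image {s · x} {s · x} (θ-fixes-nbrs s-gen) t-gen
         | neighbour-image {t · x} {t · x} (θ-fixes-nbrs t-gen) s-gen
    ... | u , u-gen , θtsx≈usx | v , v-gen , θstx≈vtx = λ m →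
      trans (θtsx≈vtx m) (trans (v≈s _) (sym (ts≈st _)))
      where
      ts≈st : t · s ≈ s · t
      ts≈st = IsAdjSwap-comm (isAdjSwap t-gen) (isAdjSwap s-gen) (Far-sym far)
      θtsx≈vtx : θ (t · (s · x)) ≈ v · (t · x)
      θtsx≈vtx m = trans (θ-cong {t · (s · x)} {s · (t · x)} (λ m → ts≈st (x ⟨$⟩ʳ m)) m) (θstx≈vtx m)
      k≢i : index u-gen ≢ index s-gen
      k≢i k≡i = proj₁ far (index-cong t-gen s-gen (back-edge {t = t} {u} s-gen θtsx≈usx (Generator-unique u-gen s-gen k≡i)))
      v≈s : v ≈ s
      v≈s = Generator-unique v-gen s-gen (square-far s-gen t-gen u-gen v-gen
              (·-cancelʳ {g = u · s} {v · t} x λ m → trans (sym (θtsx≈usx m)) (θtsx≈vtx m)) far k≢i)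

    -- θ maps the six-cycle x, s x, t s x, s t s x = t s t x, s t x, t x to a walk from x to t x,
    -- which forces t s u = w′ w v.
    hexagon : ∀ {s t u} (s-gen : Generator s) (t-gen : Generator t) (u-gen : Generator u) →
              Adjacent (index s-gen) (index t-gen) → Adjacent (index s-gen) (index u-gen) →
              index u-gen ≢ index t-gen → θ (t · (s · x)) ≈ u · (s · x) → ⊥
    hexagon {s} {t} {u} s-gen t-gen u-gen adj-ij adj-ik k≢j θtsx≈usx =
      let s-swap = isAdjSwap s-gen
          t-swap = isAdjSwap t-gen
          (v , v-gen , θstsx≈vusx) = neighbour-image {t · (s · x)} {u · (s · x)} θtsx≈usx s-gen
          (w , w-gen , θtstsx≈wvusx) = neighbour-image {s · (t · (s · x))} {v · (u · (s · x))} θstsx≈vusx t-gen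
          stx≈tstsx : s · (t · x) ≈ t · (s · (t · (s · x)))
          stx≈tstsx m = sym (trans (IsAdjSwap-braid t-swap s-swap (Adjacent-sym adj-ij) _)
                                   (cong ((s ⟨$⟩ʳ_) ∘ (t ⟨$⟩ʳ_)) (IsAdjSwap-involutive s-swap _)))
          θstx≈wvusx : θ (s · (t · x)) ≈ w · (v · (u · (s · x)))
          θstx≈wvusx m = trans (θ-cong {s · (t · x)} {t · (s · (t · (s · x)))} stx≈tstsx m) (θtstsx≈wvusx m)
          (w′ , w′-gen , θsstx≈w′wvusx) = neighbour-image {s · (t · x)} {w · (v · (u · (s · x)))} θstx≈wvusx s-gen
          tx≈w′wvusx : t · x ≈ w′ · (w · (v · (u · (s · x))))
          tx≈w′wvusx m = trans (sym (θ-fixes-nbrs t-gen m))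
            (trans (θ-cong {t · x} {s · (s · (t · x))} (λ m → sym (IsAdjSwap-involutive s-swap _)) m) (θsstx≈w′wvusx m))
          t≈w′wvus : t ≈ w′ · (w · (v · (u · s)))
          t≈w′wvus = ·-cancelʳ {g = t} {w′ · (w · (v · (u · s)))} x tx≈w′wvusx
          tsu≈w′wv : t · (s · u) ≈ w′ · (w · v)
          tsu≈w′wv m = trans (t≈w′wvus _) (cong ((w′ ⟨$⟩ʳ_) ∘ (w ⟨$⟩ʳ_) ∘ (v ⟨$⟩ʳ_))
            (trans (cong (u ⟨$⟩ʳ_) (IsAdjSwap-involutive s-swap _)) (IsAdjSwap-involutive (isAdjSwap u-gen) m)))
          v≢u : index v-gen ≢ index u-gen
          v≢u l≡k = Adjacent⇒≢ adj-ij (index-cong t-gen s-gen (backtrack {t = t} {x} s-gen (·-cancelˡ s {t · (s · x)} {x}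
            (injective {s · (t · (s · x))} {s · x} λ m → trans (θstsx≈vusx m) (trans (Generator-unique v-gen u-gen l≡k _)
              (trans (IsAdjSwap-involutive (isAdjSwap u-gen) _) (sym (θ-fixes-nbrs s-gen m))))))))
      in v≢u (staircase-unique s-gen t-gen u-gen v-gen w-gen w′-gen adj-ij adj-ik k≢j tsu≈w′wv)

    fixed-adjacent : ∀ {s t} (s-gen : Generator s) (t-gen : Generator t) →
                     Adjacent (index s-gen) (index t-gen) → θ (t · (s · x)) ≈ t · (s · x)
    fixed-adjacent {s} {t} s-gen t-gen adj-ij
      with neighbour-image {s · x} {s · x} (θ-fixes-nbrs s-gen) t-gen
    ... | u , u-gen , θtsx≈usx with index u-gen ≟ index t-gen | classify (index s-gen) (index u-gen)
    ...   | yes k≡j | _ = λ m → trans (θtsx≈usx m) (Generator-unique u-gen t-gen k≡j _)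
    ...   | no  k≢j | inj₁ i≡k = ⊥-elim (Adjacent⇒≢ adj-ij (index-cong t-gen s-gen
            (back-edge {t = t} {u} s-gen θtsx≈usx (Generator-unique u-gen s-gen (sym i≡k)))))
    ...   | no  k≢j | inj₂ (inj₁ adj-ik) = ⊥-elim (hexagon s-gen t-gen u-gen adj-ij adj-ik k≢j θtsx≈usx)
    ...   | no  k≢j | inj₂ (inj₂ far-ik) = ⊥-elim (k≢j (index-cong t-gen u-gen (·-cancelʳ {g = t} {u} (s · x)
            (injective {t · (s · x)} {u · (s · x)} λ m → trans (θtsx≈usx m) (sym (fixed-far s-gen u-gen far-ik m))))))

    fixed-two-steps : ∀ {s t} (s-gen : Generator s) (t-gen : Generator t) → θ (t · (s · x)) ≈ t · (s · x)
    fixed-two-steps {s} {t} s-gen t-gen with classify (index s-gen) (index t-gen)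
    ... | inj₁ i≡j = λ m → trans (θ-cong {t · (s · x)} {x} tsx≈x m) (trans (θx≈x m) (sym (tsx≈x m)))
      where
      tsx≈x : t · (s · x) ≈ x
      tsx≈x m = trans (Generator-unique t-gen s-gen (sym i≡j) _) (IsAdjSwap-involutive (isAdjSwap s-gen) _)
    ... | inj₂ (inj₁ adj) = fixed-adjacent s-gen t-gen adj
    ... | inj₂ (inj₂ far) = fixed-far s-gen t-gen far

  StarFixed : Sym n → Set
  StarFixed x = θ x ≈ x × (∀ {u} → Generator u → θ (u · x) ≈ u · x)

  StarFixed-step : ∀ {x s} → StarFixed x → Generator s → StarFixed (s · x)
  StarFixed-step (θx≈x , θ-fixes-nbrs) s-gen = θ-fixes-nbrs s-gen , fixed-two-steps θx≈x θ-fixes-nbrs s-gen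

  StarFixed-resp : ∀ {x y} → x ≈ y → StarFixed x → StarFixed y
  StarFixed-resp {x} {y} x≈y (θx≈x , θ-fixes-nbrs) =
    (λ m → trans (θ-cong {y} {x} (λ m → sym (x≈y m)) m) (trans (θx≈x m) (x≈y m))) ,
    λ {u} u-gen m → trans (θ-cong {u · y} {u · x} (λ m → cong (u ⟨$⟩ʳ_) (sym (x≈y m))) m)
                          (trans (θ-fixes-nbrs u-gen m) (cong (u ⟨$⟩ʳ_) (x≈y m)))

-- S_n is generated by adjacent transpositions

data Generated {n : ℕ} : Sym n → Set where
  gen-id   : ∀ {x} → x ≈ idₚ → Generated x
  gen-step : ∀ {x s y} → Generator s → Generated y → x ≈ s · y → Generated x

module _ {n : ℕ} where

  Generated-resp : {x y : Sym n} → x ≈ y → Generated x → Generated y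
  Generated-resp x≈y (gen-id x≈id)           = gen-id λ m → trans (sym (x≈y m)) (x≈id m)
  Generated-resp x≈y (gen-step s-gen gy x≈sy) = gen-step s-gen gy λ m → trans (sym (x≈y m)) (x≈sy m)

  Generated-· : {x r : Sym n} → Generated x → Generated r → Generated (x · r)
  Generated-· {r = r} (gen-id x≈id) gr = Generated-resp (λ m → sym (x≈id (r ⟨$⟩ʳ m))) gr
  Generated-· {r = r} (gen-step s-gen gy x≈sy) gr = gen-step s-gen (Generated-· gy gr) λ m → x≈sy (r ⟨$⟩ʳ m)

  Generated-generator : {s : Sym n} → Generator s → Generated s
  Generated-generator s-gen = gen-step {y = idₚ} s-gen (gen-id λ _ → refl) λ _ → refl

  transpose-generated-at : ∀ d (i j : Fin n) → toℕ j ≡ suc (toℕ i + d) → Generated (transpose i j)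
  transpose-generated-at zero i j j≡si =
    Generated-generator (InS⇒Generator (i , j , trans j≡si (cong suc (+-identityʳ _)) , λ _ → refl))
  transpose-generated-at (suc d) i j j≡i+sd =
    Generated-resp g[ij′]g≈ij (Generated-· {x = g · transpose i j′} {g}
      (gen-step {y = transpose i j′} g-gen (transpose-generated-at d i j′ j′≡i+d) λ _ → refl)
      (Generated-generator g-gen))
    where
    c = toℕ i + suc d
    sc<n : suc c < n
    sc<n = subst (_< n) j≡i+sd (toℕ<n j)
    g = generator c sc<n
    g-gen = generator-Generator c sc<n
    j′ = point c sc<n
    j′≡i+d : toℕ j′ ≡ suc (toℕ i + d)
    j′≡i+d = trans (toℕ-fromℕ< _) (+-suc (toℕ i) d)
    g[ij′]g≈ij : g · transpose i j′ · g ≈ transpose i j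
    g[ij′]g≈ij m = toℕ-injective (begin
      toℕ (g ⟨$⟩ʳ (transpose i j′ ⟨$⟩ʳ (g ⟨$⟩ʳ m)))           ≡⟨ toℕ-apply (isAdjSwap g-gen) _ ⟩
      adjSwap c (toℕ (transpose i j′ ⟨$⟩ʳ (g ⟨$⟩ʳ m)))         ≡⟨ cong (adjSwap c) (toℕ-transpose i j′ (g ⟨$⟩ʳ m)) ⟩
      adjSwap c (transposeℕ (toℕ i) (toℕ j′) (toℕ (g ⟨$⟩ʳ m))) ≡⟨ cong₂ (λ a b → adjSwap c (transposeℕ (toℕ i) a b))
                                                                    (toℕ-fromℕ< _) (toℕ-apply (isAdjSwap g-gen) m) ⟩
      adjSwap c (transposeℕ (toℕ i) c (adjSwap c (toℕ m)))     ≡⟨ transposeℕ-conj (toℕ i) c (m<m+n (toℕ i) z<s) (toℕ m) ⟨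
      transposeℕ (toℕ i) (suc c) (toℕ m)                       ≡⟨ cong (λ a → transposeℕ (toℕ i) a (toℕ m)) j≡i+sd ⟨
      transposeℕ (toℕ i) (toℕ j) (toℕ m)                       ≡⟨ toℕ-transpose i j m ⟨
      toℕ (transpose i j ⟨$⟩ʳ m)                                ∎)
      where open ≡-Reasoning

  transpose-generated : (i j : Fin n) → Generated (transpose i j)
  transpose-generated i j with <-cmp (toℕ i) (toℕ j)
  ... | tri< i<j _ _ = transpose-generated-at _ i j (sym (m+[n∸m]≡n i<j))
  ... | tri≈ _ i≡j _ = gen-id λ m → toℕ-injective (begin
    toℕ (transpose i j ⟨$⟩ʳ m)          ≡⟨ toℕ-transpose i j m ⟩
    transposeℕ (toℕ i) (toℕ j) (toℕ m)  ≡⟨ cong (λ a → transposeℕ (toℕ i) a (toℕ m)) i≡j ⟨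
    transposeℕ (toℕ i) (toℕ i) (toℕ m)  ≡⟨ transposeℕ-self (toℕ i) (toℕ m) ⟩
    toℕ m                               ∎)
    where open ≡-Reasoning
  ... | tri> _ _ j<i = Generated-resp (λ m → toℕ-injective (begin
    toℕ (transpose j i ⟨$⟩ʳ m)          ≡⟨ toℕ-transpose j i m ⟩
    transposeℕ (toℕ j) (toℕ i) (toℕ m)  ≡⟨ transposeℕ-comm (toℕ j) (toℕ i) (toℕ m) ⟩
    transposeℕ (toℕ i) (toℕ j) (toℕ m)  ≡⟨ toℕ-transpose i j m ⟨
    toℕ (transpose i j ⟨$⟩ʳ m)          ∎)) (transpose-generated-at _ j i (sym (m+[n∸m]≡n j<i)))
    where open ≡-Reasoning

  eval-generated : (xs : TranspositionList n) → Generated (eval xs)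
  eval-generated []             = gen-id λ _ → refl
  eval-generated ((i , j) ∷ xs) = Generated-· (eval-generated xs) (transpose-generated i j)

  all-generated : (π : Sym n) → Generated π
  all-generated π = Generated-resp (eval-decompose π) (eval-generated (decompose π))

rigidity : ∀ {n} {θ : Sym n → Sym n} → IsEmbedding θ → θ idₚ ≈ idₚ → (∀ {s} → Generator s → θ s ≈ s) →
           ∀ x → θ x ≈ x
rigidity {θ = θ} θ-emb θ-id θ-gen x = proj₁ (star-fixed (all-generated x))
  where
  open Rigidity θ-emb
  star-fixed : ∀ {y} → Generated y → StarFixed y
  star-fixed (gen-id y≈id) = StarFixed-resp (λ m → sym (y≈id m))
    (θ-id , λ {u} u-gen m → trans (IsEmbedding.resp-≈ θ-emb {u · idₚ} {u} (λ _ → refl) m) (θ-gen u-gen m))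
  star-fixed (gen-step s-gen gy y≈sz) = StarFixed-resp (λ m → sym (y≈sz m)) (StarFixed-step (star-fixed gy) s-gen)

module _ {n : ℕ} where

  IsAutomorphism⇒IsEmbedding : {φ : Sym n → Sym n} → IsAutomorphism φ → IsEmbedding φ
  IsAutomorphism⇒IsEmbedding φ-aut = record
    { resp-≈ = φ-cong ; injective = injective ; adj-pres = adj-pres }
    where open IsAutomorphism φ-aut renaming (cong to φ-cong)

  IsEmbedding-∘ : {χ ψ : Sym n → Sym n} → IsEmbedding χ → IsEmbedding ψ → IsEmbedding (χ ∘ ψ)
  IsEmbedding-∘ χ-emb ψ-emb = record
    { resp-≈    = resp-≈ χ-emb ∘ resp-≈ ψ-emb
    ; injective = injective ψ-emb ∘ injective χ-emb
    ; adj-pres  = λ x y → adj-pres χ-emb _ _ ∘ adj-pres ψ-emb x y }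
    where open IsEmbedding

  translate-isAutomorphism : {φ : Sym n → Sym n} (a : Sym n) → IsAutomorphism φ → IsAutomorphism (λ x → φ x · a)
  translate-isAutomorphism {φ} a φ-aut = record
    { cong        = λ x≈y m → φ-cong x≈y (a ⟨$⟩ʳ m)
    ; injective   = λ {x} {y} φxa≈φya → injective (·-cancelʳ {g = φ x} {φ y} a φxa≈φya)
    ; surjective  = λ y → let (x , φx≈ya⁻¹) = surjective (y · a ⁻¹)
                          in x , λ m → trans (φx≈ya⁻¹ (a ⟨$⟩ʳ m)) (cong (y ⟨$⟩ʳ_) (inverseˡ a))
    ; adj-pres    = λ x y adj → let (s , sS , φy≈sφx) = adj-pres x y adj in s , sS , λ m → φy≈sφx (a ⟨$⟩ʳ m)
    ; adj-reflect = λ x y (s , sS , φya≈sφxa) → adj-reflect x y (s , sS , ·-cancelʳ {g = φ y} {s · φ x} a φya≈sφxa) }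
    where open IsAutomorphism φ-aut renaming (cong to φ-cong)

  reverse-conj : Sym n → Sym n
  reverse-conj x = σ · x · σ

  reverse-conj-involutive : (x : Sym n) → reverse-conj (reverse-conj x) ≈ x
  reverse-conj-involutive x m =
    trans (opposite-involutive _) (cong (x ⟨$⟩ʳ_) (opposite-involutive m))

  reverse-conj-isAdjSwap : ∀ {k k′} {g : Sym n} → suc (suc (k + k′)) ≡ n → IsAdjSwap k′ g → IsAdjSwap k (reverse-conj g)
  reverse-conj-isAdjSwap {k} {k′} {g} eq g-swap = record { toℕ-apply = λ m →
    let q  = toℕ m
        q′ = n ∸ suc q
        r  = adjSwap k′ q′
        n≡sq+q′ : suc (q + q′) ≡ n
        n≡sq+q′ = m+[n∸m]≡n (toℕ<n m)
        reflected : adjSwap k q + r ≡ q + q′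
        reflected = adjSwap-reflect k k′ q q′ (suc-injective (trans eq (sym n≡sq+q′)))
    in begin
      toℕ (opposite (g ⟨$⟩ʳ opposite m))   ≡⟨ opposite-prop _ ⟩
      n ∸ suc (toℕ (g ⟨$⟩ʳ opposite m))    ≡⟨ cong (λ z → n ∸ suc z) (toℕ-apply g-swap _) ⟩
      n ∸ suc (adjSwap k′ (toℕ (opposite m))) ≡⟨ cong (λ z → n ∸ suc (adjSwap k′ z)) (opposite-prop m) ⟩
      n ∸ suc r                            ≡⟨ cong (_∸ suc r) (trans (sym n≡sq+q′) (cong suc (sym reflected))) ⟩
      suc (adjSwap k q + r) ∸ suc r        ≡⟨ m+n∸n≡m (adjSwap k q) r ⟩
      adjSwap k q                          ∎ }
    where open ≡-Reasoning

  reverse-conj-Generator : {s : Sym n} → Generator s → Generator (reverse-conj s)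
  reverse-conj-Generator s-gen = record
    { index = K ; index-bound = subst (suc (suc K) ≤_) K+i≡n (s≤s (s≤s (m≤m+n K i)))
    ; isAdjSwap = reverse-conj-isAdjSwap K+i≡n (isAdjSwap s-gen) }
    where
    i = index s-gen
    K = n ∸ suc (suc i)
    K+i≡n : suc (suc (K + i)) ≡ n
    K+i≡n = trans (cong (suc ∘ suc) (+-comm K i)) (m+[n∸m]≡n (index-bound s-gen))

  reverse-conj-isEmbedding : IsEmbedding reverse-conj
  reverse-conj-isEmbedding = record
    { resp-≈    = λ x≈y m → cong opposite (x≈y (opposite m))
    ; injective = λ {x} {y} σxσ≈σyσ m → trans (sym (reverse-conj-involutive x m))
                    (trans (cong opposite (σxσ≈σyσ (opposite m))) (reverse-conj-involutive y m))
    ; adj-pres  = λ x y (s , sS , y≈sx) →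
                    reverse-conj s , Generator⇒InS (reverse-conj-Generator (InS⇒Generator {s = s} sS)) ,
                    λ m → cong opposite (trans (y≈sx (opposite m)) (cong (s ⟨$⟩ʳ_) (sym (opposite-involutive _)))) }

-- The automorphism induced on the path of generators

module _ (N : ℕ) (f : ℕ → ℕ)
         (f-bound : ∀ {k} → k ≤ N → f k ≤ N)
         (f-injective : ∀ {k k′} → k ≤ N → k′ ≤ N → f k ≡ f k′ → k ≡ k′)
         (f-adjacent : ∀ {k} → k < N → Adjacent (f k) (f (suc k))) where

  private
    no-backtrack : ∀ {k} → suc (suc k) ≤ N → f (suc (suc k)) ≢ f k
    no-backtrack {k} ssk≤N eq = m≢1+n+m k (sym (f-injective ssk≤N (m+n≤o⇒n≤o 2 ssk≤N) eq))

    ascending : f 1 ≡ suc (f 0) → ∀ {k} → k < N → f (suc k) ≡ suc (f k)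
    ascending f1 {zero}  _     = f1
    ascending f1 {suc k} sk<N with f-adjacent sk<N
    ... | inj₁ up   = up
    ... | inj₂ down = ⊥-elim (no-backtrack sk<N
                        (suc-injective (trans (sym down) (ascending f1 (≤-trans (n≤1+n _) sk<N)))))

    descending : f 0 ≡ suc (f 1) → ∀ {k} → k < N → f k ≡ suc (f (suc k))
    descending f0 {zero}  _     = f0
    descending f0 {suc k} sk<N with f-adjacent sk<N
    ... | inj₂ down = down
    ... | inj₁ up   = ⊥-elim (no-backtrack sk<N (trans up (sym (descending f0 (≤-trans (n≤1+n _) sk<N)))))

    ascending-linear : f 1 ≡ suc (f 0) → ∀ {k} → k ≤ N → f k ≡ f 0 + k
    ascending-linear f1 {zero}  _    = sym (+-identityʳ _)
    ascending-linear f1 {suc k} sk≤N = trans (ascending f1 sk≤N)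
      (trans (cong suc (ascending-linear f1 (≤-trans (n≤1+n k) sk≤N))) (sym (+-suc _ k)))

    descending-linear : f 0 ≡ suc (f 1) → ∀ {k} → k ≤ N → f k + k ≡ f 0
    descending-linear f0 {zero}  _    = +-identityʳ _
    descending-linear f0 {suc k} sk≤N = trans (+-suc (f (suc k)) k)
      (trans (cong (_+ k) (sym (descending f0 sk≤N))) (descending-linear f0 (≤-trans (n≤1+n k) sk≤N)))

  path-automorphism : 0 < N → (∀ {k} → k ≤ N → f k ≡ k) ⊎ (∀ {k} → k ≤ N → f k + k ≡ N)
  path-automorphism 0<N with f-adjacent 0<N
  ... | inj₁ f1 = inj₁ λ k≤N → trans (ascending-linear f1 k≤N) (cong (_+ _) f0≡0)
    where
    f0≡0 : f 0 ≡ 0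
    f0≡0 = n≤0⇒n≡0 (+-cancelʳ-≤ N (f 0) 0 (subst (_≤ N) (ascending-linear f1 ≤-refl) (f-bound ≤-refl)))
  ... | inj₂ f0 = inj₂ λ k≤N → trans (descending-linear f0 k≤N) f0≡N
    where
    fN≡0 : f N ≡ 0
    fN≡0 = n≤0⇒n≡0 (+-cancelʳ-≤ N (f N) 0 (subst (_≤ N) (sym (descending-linear f0 ≤-refl)) (f-bound z≤n)))
    f0≡N : f 0 ≡ N
    f0≡N = trans (sym (descending-linear f0 ≤-refl)) (cong (_+ N) fN≡0)

module IndexMap {N : ℕ} {ψ : Sym (suc (suc N)) → Sym (suc (suc N))}
                (ψ-aut : IsAutomorphism ψ) (ψ-id : ψ idₚ ≈ idₚ) where
  open IsAutomorphism ψ-aut renaming (cong to ψ-cong)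

  image-Generator : {s : Sym (suc (suc N))} → Generator s → Generator (ψ s)
  image-Generator {s} s-gen with adj-pres idₚ s (s , Generator⇒InS s-gen , λ _ → refl)
  ... | u , uS , ψs≈uψid = record
    { index = index u-gen ; index-bound = index-bound u-gen
    ; isAdjSwap = IsAdjSwap-resp (λ m → trans (ψs≈uψid m) (cong (u ⟨$⟩ʳ_) (ψ-id m))) (isAdjSwap u-gen) }
    where u-gen = InS⇒Generator {s = u} uS

  images-not-far : {s t : Sym (suc (suc N))} (s-gen : Generator s) (t-gen : Generator t) →
                   index t-gen ≡ suc (index s-gen) → ¬ Far (index (image-Generator s-gen)) (index (image-Generator t-gen))
  images-not-far {s} {t} s-gen t-gen j≡si far =
    let a-gen = image-Generator s-gen
        b-gen = image-Generator t-gen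
        (z , ψz≈ab) = surjective (ψ s · ψ t)
        (α , αS , z≈αs) = adj-reflect s z (ψ t , Generator⇒InS b-gen ,
                            λ m → trans (ψz≈ab m) (IsAdjSwap-comm (isAdjSwap a-gen) (isAdjSwap b-gen) far m))
        (β , βS , z≈βt) = adj-reflect t z (ψ s , Generator⇒InS a-gen , ψz≈ab)
        β≈t : β ≈ t
        β≈t = Generator-unique (InS⇒Generator {s = β} βS) t-gen
                (square-adjacent s-gen t-gen (InS⇒Generator {s = α} αS) (InS⇒Generator {s = β} βS)
                  (λ m → trans (sym (z≈αs m)) (z≈βt m)) j≡si)
        z≈id : z ≈ idₚ
        z≈id m = trans (z≈βt m) (trans (β≈t _) (IsAdjSwap-involutive (isAdjSwap t-gen) m))
    in far-product-≉-id a-gen b-gen far λ m → trans (sym (ψz≈ab m)) (trans (ψ-cong {z} {idₚ} z≈id m) (ψ-id m))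

  private
    n = suc (suc N)

    image-at : ∀ k (sk<n : suc k < n) → Generator (ψ (generator k sk<n))
    image-at k sk<n = image-Generator (generator-Generator k sk<n)

  -- The value 0 outside the range of generator indices is junk.
  index-map : ℕ → ℕ
  index-map k with suc k <? n
  ... | yes sk<n = index (image-at k sk<n)
  ... | no  _    = 0

  index-map-image : {s : Sym n} (s-gen : Generator s) → index (image-Generator s-gen) ≡ index-map (index s-gen)
  index-map-image {s} s-gen with suc (index s-gen) <? n
  ... | no  ¬bound = ⊥-elim (¬bound (index-bound s-gen))
  ... | yes bound  = index-cong (image-at _ bound) (image-Generator s-gen)
                       (ψ-cong {generator _ bound} {s} (Generator-unique (generator-Generator _ bound) s-gen refl))

  private
    k≤N⇒bound : ∀ {k} → k ≤ N → suc k < n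
    k≤N⇒bound k≤N = s≤s (s≤s k≤N)

    index-map-at : ∀ {k} (k≤N : k ≤ N) → index (image-at k (k≤N⇒bound k≤N)) ≡ index-map k
    index-map-at k≤N = index-map-image (generator-Generator _ (k≤N⇒bound k≤N))

  index-map-bound : ∀ {k} → k ≤ N → index-map k ≤ N
  index-map-bound k≤N =
    s≤s⁻¹ (s≤s⁻¹ (subst (λ i → suc i < n) (index-map-at k≤N) (index-bound (image-at _ (k≤N⇒bound k≤N)))))

  index-map-injective : ∀ {k k′} → k ≤ N → k′ ≤ N → index-map k ≡ index-map k′ → k ≡ k′
  index-map-injective k≤N k′≤N eq =
    sym (index-cong (generator-Generator _ (k≤N⇒bound k≤N)) (generator-Generator _ (k≤N⇒bound k′≤N))
    (injective (Generator-unique (image-at _ (k≤N⇒bound k≤N)) (image-at _ (k≤N⇒bound k′≤N))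
      (trans (index-map-at k≤N) (trans eq (sym (index-map-at k′≤N)))))))

  index-map-adjacent : ∀ {k} → k < N → Adjacent (index-map k) (index-map (suc k))
  index-map-adjacent {k} sk≤N with classify (index-map k) (index-map (suc k))
  ... | inj₁ eq         = ⊥-elim (1+n≢n (sym (index-map-injective (<⇒≤ sk≤N) sk≤N eq)))
  ... | inj₂ (inj₁ adj) = adj
  ... | inj₂ (inj₂ far) = ⊥-elim (images-not-far (generator-Generator k (k≤N⇒bound (<⇒≤ sk≤N)))
                                                          (generator-Generator (suc k) (k≤N⇒bound sk≤N)) refl
                            (subst₂ Far (sym (index-map-at (<⇒≤ sk≤N))) (sym (index-map-at sk≤N)) far))

  fixes-or-reverses-generators : 0 < N → (∀ {s} → Generator s → ψ s ≈ s) ⊎ (∀ {s} → Generator s → reverse-conj (ψ s) ≈ s)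
  fixes-or-reverses-generators 0<N
    with path-automorphism N index-map index-map-bound index-map-injective index-map-adjacent 0<N
  ... | inj₁ identity = inj₁ λ s-gen → IsAdjSwap-unique (isAdjSwap (image-Generator s-gen)) (isAdjSwap s-gen)
          (trans (index-map-image s-gen) (identity (s≤s⁻¹ (s≤s⁻¹ (index-bound s-gen)))))
  ... | inj₂ reversal = inj₂ λ s-gen → IsAdjSwap-unique
          (reverse-conj-isAdjSwap (cong (suc ∘ suc) (trans (+-comm (index s-gen) _)
            (trans (cong (_+ index s-gen) (index-map-image s-gen)) (reversal (s≤s⁻¹ (s≤s⁻¹ (index-bound s-gen)))))))
            (isAdjSwap (image-Generator s-gen)))
          (isAdjSwap s-gen) refl

-- Uniqueness of the representation

σ-not-central : ∀ {n} → 3 ≤ n → ¬ (∀ (x : Sym n) → x · σ ≈ σ · x)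
σ-not-central {suc (suc (suc r))} (s≤s (s≤s (s≤s z≤n))) central = 1+n≢n (begin
  suc (suc r)                         ≡⟨ cong (adjSwap 0) (opposite-prop o) ⟨
  adjSwap 0 (toℕ (opposite o))     ≡⟨ toℕ-apply g-swap (opposite o) ⟨
  toℕ (g ⟨$⟩ʳ opposite o)          ≡⟨ cong toℕ (central g o) ⟩
  toℕ (opposite (g ⟨$⟩ʳ o))        ≡⟨ opposite-prop (g ⟨$⟩ʳ o) ⟩
  suc (suc (suc r)) ∸ suc (toℕ (g ⟨$⟩ʳ o)) ≡⟨ cong (λ z → suc (suc (suc r)) ∸ suc z) (toℕ-apply g-swap o) ⟩
  suc r                               ∎)
  where
  open ≡-Reasoning
  o : Fin (suc (suc (suc r)))
  o = zeroᶠ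
  g : Sym (suc (suc (suc r)))
  g = generator 0 (s≤s (s≤s z≤n))
  g-swap : IsAdjSwap 0 g
  g-swap = generator-isAdjSwap 0 (s≤s (s≤s z≤n))

module _ {n : ℕ} where

  InIdσ-involutive : {b : Sym n} → InIdσ b → b · b ≈ idₚ
  InIdσ-involutive (inj₁ b≈id) m = trans (b≈id _) (b≈id m)
  InIdσ-involutive (inj₂ b≈σ) m = trans (b≈σ _) (trans (cong opposite (b≈σ m)) (opposite-involutive m))

  involution-inverse : {b : Sym n} → b · b ≈ idₚ → b ⁻¹ ≈ b
  involution-inverse {b} bb≈id m = trans (cong (b ⟨$⟩ˡ_) (sym (bb≈id m))) (inverseˡ b)

  RL-≈ : {a b : Sym n} → InIdσ b → ∀ x → RL a b x ≈ b · x · a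
  RL-≈ {a} {b} ib x m = involution-inverse {b} (InIdσ-involutive {b} ib) (x ⟨$⟩ʳ (a ⟨$⟩ʳ m))

  private
    no-mixed-representation : {a a′ b b′ : Sym n} → 3 ≤ n → b ≈ idₚ → b′ ≈ σ →
                              ¬ (∀ x → b · x · a ≈ b′ · x · a′)
    no-mixed-representation {a} {a′} {b} {b′} 3≤n b≈id b′≈σ same = σ-not-central 3≤n λ x →
      ·-cancelʳ {g = x · σ} {σ · x} a′ λ m → trans (cong (x ⟨$⟩ʳ_) (sym (untwisted idₚ m))) (untwisted x m)
      where
      untwisted : ∀ x m → x ⟨$⟩ʳ (a ⟨$⟩ʳ m) ≡ opposite (x ⟨$⟩ʳ (a′ ⟨$⟩ʳ m))
      untwisted x m = trans (sym (b≈id _)) (trans (same x m) (b′≈σ _))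

  RL-unique : {a a′ b b′ : Sym n} → 3 ≤ n → InIdσ b → InIdσ b′ →
              (∀ x → RL a b x ≈ RL a′ b′ x) → (a′ ≈ a) × (b′ ≈ b)
  RL-unique {a} {a′} {b} {b′} 3≤n ib ib′ RL≈RL′ = cases ib ib′
    where
    same : ∀ x → b · x · a ≈ b′ · x · a′
    same x m = trans (sym (RL-≈ {a} {b} ib x m)) (trans (RL≈RL′ x m) (RL-≈ {a′} {b′} ib′ x m))

    same-b : b′ ≈ b → (a′ ≈ a) × (b′ ≈ b)
    same-b b′≈b = (λ m → sym (·-cancelˡ b {a} {a′} (λ m → trans (same idₚ m) (b′≈b _)) m)) , b′≈b

    cases : InIdσ b → InIdσ b′ → (a′ ≈ a) × (b′ ≈ b)
    cases (inj₁ b≈id) (inj₁ b′≈id) = same-b λ m → trans (b′≈id m) (sym (b≈id m))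
    cases (inj₂ b≈σ)  (inj₂ b′≈σ)  = same-b λ m → trans (b′≈σ m) (sym (b≈σ m))
    cases (inj₁ b≈id) (inj₂ b′≈σ)  = ⊥-elim (no-mixed-representation {a} {a′} {b} {b′} 3≤n b≈id b′≈σ same)
    cases (inj₂ b≈σ)  (inj₁ b′≈id) = ⊥-elim (no-mixed-representation {a′} {a} {b′} {b} 3≤n b′≈id b≈σ λ x m → sym (same x m))

module _ {n : ℕ} {φ : Sym n → Sym n} where

  represented-by : (b : Sym n) → (∀ x → φ x · φ idₚ ⁻¹ ≈ b ⁻¹ · x · b) → RepresentedBy φ (b · φ idₚ) b
  represented-by b normal x m = trans (cong (φ x ⟨$⟩ʳ_) (sym (inverseˡ (φ idₚ)))) (normal x (φ idₚ ⟨$⟩ʳ m))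

  unique-representation : {a b : Sym n} → 3 ≤ n → InIdσ b → RepresentedBy φ a b →
    Σ (Sym n) λ a → Σ (Sym n) λ b →
      (InIdσ b × RepresentedBy φ a b) ×
      (∀ a′ b′ → InIdσ b′ → RepresentedBy φ a′ b′ → (a′ ≈ a) × (b′ ≈ b))
  unique-representation {a} {b} 3≤n ib rep = a , b , (ib , rep) ,
    λ a′ b′ ib′ rep′ → RL-unique {a = a} {a′} {b} {b′} 3≤n ib ib′ λ x m → trans (sym (rep x m)) (rep′ x m)

module Normalised {n : ℕ} {φ : Sym n → Sym n} (φ-aut : IsAutomorphism φ) where

  ψ : Sym n → Sym n
  ψ x = φ x · φ idₚ ⁻¹

  ψ-isAutomorphism : IsAutomorphism ψ
  ψ-isAutomorphism = translate-isAutomorphism (φ idₚ ⁻¹) φ-aut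

  ψ-id : ψ idₚ ≈ idₚ
  ψ-id = ·-inverseʳ (φ idₚ)

  private
    ψ-emb : IsEmbedding ψ
    ψ-emb = IsAutomorphism⇒IsEmbedding ψ-isAutomorphism

  represented-if-fixing : (∀ {s} → Generator s → ψ s ≈ s) → RepresentedBy φ (idₚ · φ idₚ) idₚ
  represented-if-fixing ψ-fixes = represented-by {φ = φ} idₚ λ x → rigidity ψ-emb ψ-id ψ-fixes x

  represented-if-reversing : (∀ {s} → Generator s → reverse-conj (ψ s) ≈ s) → RepresentedBy φ (σ · φ idₚ) σ
  represented-if-reversing ψ-reverses = represented-by {φ = φ} σ λ x m →
    trans (sym (reverse-conj-involutive (ψ x) m))
          (IsEmbedding.resp-≈ reverse-conj-isEmbedding {reverse-conj (ψ x)} {x} (rigidity θ-emb θ-id ψ-reverses x) m)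
    where
    θ-emb : IsEmbedding (reverse-conj ∘ ψ)
    θ-emb = IsEmbedding-∘ reverse-conj-isEmbedding ψ-emb
    θ-id : reverse-conj (ψ idₚ) ≈ idₚ
    θ-id m = trans (cong opposite (ψ-id (opposite m))) (opposite-involutive m)

mainTheorem6 : (n : ℕ) → 3 ≤ n → (φ : Sym n → Sym n) → IsAutomorphism φ →
    Σ (Sym n) λ a → Σ (Sym n) λ b →
    (InIdσ b × RepresentedBy φ a b) ×
    (∀ a′ b′ → InIdσ b′ → RepresentedBy φ a′ b′ → (a′ ≈ a) × (b′ ≈ b))
mainTheorem6 (suc (suc N)) 3≤n@(s≤s (s≤s 0<N)) φ φ-aut
  with IndexMap.fixes-or-reverses-generators (Normalised.ψ-isAutomorphism φ-aut) (Normalised.ψ-id φ-aut) 0<N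
... | inj₁ ψ-fixes    = unique-representation {φ = φ} {idₚ · φ idₚ} {idₚ} 3≤n (inj₁ λ _ → refl)
                          (Normalised.represented-if-fixing φ-aut ψ-fixes)
... | inj₂ ψ-reverses = unique-representation {φ = φ} {σ · φ idₚ} {σ} 3≤n (inj₂ λ _ → refl)
                          (Normalised.represented-if-reversing φ-aut ψ-reverses)
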